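{- Let $X$ be a finite pure $d$-dimensional simplicial complex, $0\le i<d$, and $0<\eta<1$. Then for every $i$-cochain $W\subseteq X(i)$ and every $0\le j\le i$, $$\Pr\big[P_{i+1}\in F^{i+1}(W)\wedge P_{j-1}\notin S^{j-1}(W)\big]\le\Pr\big[P_{j+1}\in F^{j+1}(W)\wedge P_{j-1}\notin S^{j-1}(W)\big]+\sum_{k=j+2}^{i+1}\Pr\big[P_k\in F^k(W)\wedge P_{k-1}\notin F^{k-1}(W)\big].$$
   Context: A simplicial complex $X$ on a finite vertex set is a family of subsets (faces) closed under taking subsets; it contains $\emptyset$. A face $\sigma$ has dimension $|\sigma|-1$; $X(i)$ is the set of $i$-faces, $X(-1)=\{\emptyset\}$. $X$ is $d$-dimensional if its maximal face dimension is $d$, pure if every face lies in a $d$-face. $\deg(\sigma)$ is the number of $d$-faces containing $\sigma$. Random faces: $P_d$ is a uniformly random $d$-face, and for $k=d-1,\dots,-1$, $P_k$ is obtained from $P_{k+1}$ by deleting a uniformly random vertex (independently). For $U\subseteq X(k)$, $\|U\|=\Pr[P_k\in U]$. The link of $\sigma$ is $X_\sigma=\{\tau\setminus\sigma:\tau\in X,\tau\supseteq\sigma\}$ and $\|\cdot\|_\sigma$ is the analogous norm inside $X_\sigma$ (degrees = numbers of top faces of $X_\sigma$). For $U\subseteq X(k)$ and a face $\sigma$ of dimension $<k$, $U_\sigma=\{\tau\in X_\sigma:\tau\sqcup\sigma\in U\}$. Fat faces (fatness constant $\eta$): $S^i(W)=W$, and for $-1\le j<i$, $S^j(W)=\{\sigma\in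 X(j):\|S^{j+1}(W)_\sigma\|_\sigma\ge\eta^{2^{i-j-1}}\}$. Full faces: for $0\le j\le i+1$, $F^j(W)=\{\tau\in X(j):\text{every }(j-1)\text{ -dimensional face }\sigma\subset\tau\text{ lies in }S^{j-1}(W)\}$.
   Formalization: The fatness constant η ranges over the rationals in the interval 0<η<1. -}

module Defs where

-- To avoid dimension -1 we index faces by their SIZE (= dimension + 1):
-- a face of dimension k has size k+1. So "P_k" of the paper is written
-- (P X t (k+1)) below, where t = d+1 is the size of the top faces.

open import Data.Nat as ℕ using (ℕ; zero; suc; _∸_)
open import Data.Bool using (Bool; true; false; _∧_; _∨_; not; if_then_else_)
open import Data.Fin using (Fin)
open import Data.Fin.Subset using (Subset; _∪_; _∩_; ∣_∣; ⊥)
open import Data.Vec using (Vec; []; _∷_)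
open import Data.List using (List; []; _∷_; map; concatMap; filterᵇ; length; upTo; foldr)
open import Data.Bool.ListAction using (and)
open import Data.Product using (_×_; _,_)
open import Data.Integer using (+_)
open import Data.Rational using (ℚ; 0ℚ; 1ℚ; _/_; _*_; _+_; _≤?_)
open import Relation.Nullary using (does)
open import Relation.Binary.PropositionalEquality using (_≡_)

allSubsets : (n : ℕ) → List (Subset n)
allSubsets zero = [] ∷ []
allSubsets (suc n) = concatMap (λ s → (false ∷ s) ∷ (true ∷ s) ∷ []) (allSubsets n)

_⊆ᵇ_ : {n : ℕ} → Subset n → Subset n → Bool
[] ⊆ᵇ [] = true
(true ∷ s) ⊆ᵇ (false ∷ t) = false
(_ ∷ s) ⊆ᵇ (_ ∷ t) = s ⊆ᵇ t

disjointᵇ : {n : ℕ} → Subset n → Subset n → Bool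
disjointᵇ [] [] = true
disjointᵇ (true ∷ s) (true ∷ t) = false
disjointᵇ (_ ∷ s) (_ ∷ t) = disjointᵇ s t

Complex : ℕ → Set
Complex n = Subset n → Bool

FaceSet : ℕ → Set
FaceSet n = Subset n → Bool

IsComplex : {n : ℕ} → Complex n → Set
IsComplex {n} X = (X ⊥ ≡ true)
  × ((σ τ : Subset n) → X τ ≡ true → σ ⊆ᵇ τ ≡ true → X σ ≡ true)

IsPure : {n : ℕ} → Complex n → ℕ → Set
IsPure {n} X d = ((σ : Subset n) → X σ ≡ true → ∣ σ ∣ ℕ.≤ suc d)
  × ((σ : Subset n) → X σ ≡ true →
       Data.Product.Σ (Subset n) (λ τ → (X τ ≡ true) × (σ ⊆ᵇ τ ≡ true) × (∣ τ ∣ ≡ suc d)))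

_==_ : ℕ → ℕ → Bool
m == k = does (m ℕ.≟ k)

removeNth : {n : ℕ} → ℕ → Subset n → Subset n
removeNth r [] = []
removeNth r (false ∷ s) = false ∷ removeNth r s
removeNth zero (true ∷ s) = false ∷ s
removeNth (suc r) (true ∷ s) = true ∷ removeNth r s

-- Sample space of the random process (P_d, P_{d-1}, ..., P_{-1}) for a
-- complex whose top faces have size t: a top face together with the
-- sequence of independent uniform deletion choices r_1 < t, r_2 < t-1, ...,
-- r_t < 1 (r_l = index of the vertex deleted at step l).
Outcome : ℕ → Set
Outcome n = Subset n × List ℕ

choices : ℕ → List (List ℕ)
choices zero = [] ∷ []
choices (suc m) = concatMap (λ r → map (r ∷_) (choices m)) (upTo (suc m))

topFaces : {n : ℕ} → Complex n → ℕ → List (Subset n)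
topFaces {n} Y t = filterᵇ (λ σ → Y σ ∧ (∣ σ ∣ == t)) (allSubsets n)

outcomes : {n : ℕ} → Complex n → ℕ → List (Outcome n)
outcomes Y t = concatMap (λ τ → map (τ ,_) (choices t)) (topFaces Y t)

dels : {n : ℕ} → ℕ → Subset n → List ℕ → Subset n
dels zero σ rs = σ
dels (suc k) σ [] = σ
dels (suc k) σ (r ∷ rs) = dels k (removeNth r σ) rs

P : {n : ℕ} → ℕ → ℕ → Outcome n → Subset n
P t m (τ , rs) = dels (t ∸ m) τ rs

frac : ℕ → ℕ → ℚ
frac a zero = 0ℚ
frac a (suc b) = (+ a) / suc b

count : {A : Set} → (A → Bool) → List A → ℕ
count p xs = length (filterᵇ p xs)

-- Probability of an event under the (uniform, product) distribution of
-- the process on complex Y with top-face size t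
Pr : {n : ℕ} → Complex n → ℕ → (Outcome n → Bool) → ℚ
Pr Y t E = frac (count E (outcomes Y t)) (length (outcomes Y t))

norm : {n : ℕ} → Complex n → ℕ → ℕ → FaceSet n → ℚ
norm Y t m U = Pr Y t (λ ω → U (P t m ω))

-- link of σ: X_σ = {τ \ σ : σ ⊆ τ ∈ X} = {ρ : ρ ∩ σ = ∅, ρ ∪ σ ∈ X}
link : {n : ℕ} → Complex n → Subset n → Complex n
link X σ ρ = disjointᵇ ρ σ ∧ X (ρ ∪ σ)

restrict : {n : ℕ} → Complex n → FaceSet n → Subset n → FaceSet n
restrict X U σ ρ = link X σ ρ ∧ U (ρ ∪ σ)

linkNorm : {n : ℕ} → Complex n → ℕ → ℕ → FaceSet n → Subset n → ℚ
linkNorm X t m U σ = norm (link X σ) (t ∸ ∣ σ ∣) (m ∸ ∣ σ ∣) (restrict X U σ)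

powℚ : ℚ → ℕ → ℚ
powℚ q zero = 1ℚ
powℚ q (suc e) = q * powℚ q e

_≤ᵇ_ : ℚ → ℚ → Bool
p ≤ᵇ q = does (p Data.Rational.≤? q)

-- W ⊆ X(i) consists of faces of size I = i+1; fatD g is
-- S^{i-g}(W), the fat faces of size I - g:
--   S^i(W) = W,
--   S^j(W) = {σ ∈ X(j) : ‖S^{j+1}(W)_σ‖_σ ≥ η^(2^(i-j-1))}
-- (with j = i - g - 1 we have i - j - 1 = g).
fatD : {n : ℕ} → Complex n → ℕ → ℚ → ℕ → FaceSet n → ℕ → FaceSet n
fatD X t η I W zero = W
fatD X t η I W (suc g) σ =
  X σ ∧ (∣ σ ∣ == (I ∸ suc g))
      ∧ (powℚ η (2 ℕ.^ g) ≤ᵇ linkNorm X t (I ∸ g) (fatD X t η I W g) σ)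

S : {n : ℕ} → Complex n → ℕ → ℚ → ℕ → FaceSet n → ℕ → FaceSet n
S X t η I W s = fatD X t η I W (I ∸ s)

F : {n : ℕ} → Complex n → ℕ → ℚ → ℕ → FaceSet n → ℕ → FaceSet n
F {n} X t η I W s τ =
  X τ ∧ (∣ τ ∣ == s)
      ∧ and (map (λ σ → not ((σ ⊆ᵇ τ) ∧ (∣ σ ∣ == (s ∸ 1))) ∨ S X t η I W (s ∸ 1) σ)
            (allSubsets n))

sumℚ : List ℚ → ℚ
sumℚ = foldr _+_ 0ℚ

-- Every outcome in which P_{k+1} is full but P_{j-1} is not fat either already has P_k full
-- (and P_{j-1} not fat), or has P_{k+1} full and P_k not full. The union bound turns this
-- into a one-step inequality, and telescoping it from k = j+1 to k = i gives the claim.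
-- The argument uses nothing about X, η or W.
module Submission where

open import Defs
open import Data.Nat using (ℕ; zero; suc; _+_; _*_; _∸_; _≤_; _<_; s≤s)
import Data.Nat.Properties as ℕ
open import Data.Bool using (Bool; true; false; _∧_; _∨_; not)
open import Data.List using (List; []; _∷_; length; map; upTo; applyUpTo)
import Data.List.Properties as List
open import Data.Fin.Subset using (∣_∣)
open import Data.Product using (_×_)
open import Data.Integer as ℤ using (+_; +≤+)
import Data.Integer.Properties as ℤ
open import Data.Integer.Tactic.RingSolver using (solve-∀)
open import Data.Rational using (ℚ; 0ℚ; 1ℚ; toℚᵘ) renaming (_<_ to _<ℚ_; _≤_ to _≤ℚ_; _+_ to _+ℚ_)
import Data.Rational.Properties as ℚ
open import Data.Rational.Unnormalised as ℚᵘ using (mkℚᵘ; *≡*; *≤*) renaming (_≃_ to _≃ᵘ_; _≤_ to _≤ᵘ_)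
import Data.Rational.Unnormalised.Properties as ℚᵘ
open import Function using (_∘_)
open import Relation.Binary.PropositionalEquality
  using (_≡_; refl; sym; trans; cong; cong₂; subst; subst₂; module ≡-Reasoning)

mkℚᵘ-mono-≤ : ∀ {a b} m → a ≤ b → mkℚᵘ (+ a) m ≤ᵘ mkℚᵘ (+ b) m
mkℚᵘ-mono-≤ {a} {b} m a≤b =
  *≤* (subst₂ ℤ._≤_ (ℤ.pos-* a (suc m)) (ℤ.pos-* b (suc m)) (+≤+ (ℕ.*-monoˡ-≤ (suc m) a≤b)))

mkℚᵘ-+ : ∀ a b m → mkℚᵘ (+ (a + b)) m ≃ᵘ mkℚᵘ (+ a) m ℚᵘ.+ mkℚᵘ (+ b) m
mkℚᵘ-+ a b m = *≡* (begin
  + (a + b) ℤ.* + (suc m * suc m)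
    ≡⟨ cong₂ ℤ._*_ (ℤ.pos-+ a b) (ℤ.pos-* (suc m) (suc m)) ⟩
  (+ a ℤ.+ + b) ℤ.* (+ suc m ℤ.* + suc m)
    ≡⟨ distrib (+ a) (+ b) (+ suc m) ⟩
  (+ a ℤ.* + suc m ℤ.+ + b ℤ.* + suc m) ℤ.* + suc m ∎)
  where
  open ≡-Reasoning
  distrib : ∀ x y z → (x ℤ.+ y) ℤ.* (z ℤ.* z) ≡ (x ℤ.* z ℤ.+ y ℤ.* z) ℤ.* z
  distrib = solve-∀

frac-mono-≤ : ∀ {a b} N → a ≤ b → frac a N ≤ℚ frac b N
frac-mono-≤ zero _ = ℚ.≤-refl
frac-mono-≤ {a} {b} (suc m) a≤b = ℚ.toℚᵘ-cancel-≤ (begin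
  toℚᵘ (frac a (suc m)) ≃⟨ ℚ.toℚᵘ-fromℚᵘ (mkℚᵘ (+ a) m) ⟩
  mkℚᵘ (+ a) m          ≤⟨ mkℚᵘ-mono-≤ m a≤b ⟩
  mkℚᵘ (+ b) m          ≃⟨ ℚ.toℚᵘ-fromℚᵘ (mkℚᵘ (+ b) m) ⟨
  toℚᵘ (frac b (suc m)) ∎)
  where open ℚᵘ.≤-Reasoning

frac-+ : ∀ a b N → frac (a + b) N ≡ frac a N +ℚ frac b N
frac-+ a b zero = sym (ℚ.+-identityʳ 0ℚ)
frac-+ a b (suc m) = ℚ.toℚᵘ-injective (begin-equality
  toℚᵘ (frac (a + b) (suc m))                   ≃⟨ ℚ.toℚᵘ-fromℚᵘ (mkℚᵘ (+ (a + b)) m) ⟩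
  mkℚᵘ (+ (a + b)) m                            ≃⟨ mkℚᵘ-+ a b m ⟩
  mkℚᵘ (+ a) m ℚᵘ.+ mkℚᵘ (+ b) m                ≃⟨ ℚᵘ.+-cong (ℚ.toℚᵘ-fromℚᵘ (mkℚᵘ (+ a) m))
                                                              (ℚ.toℚᵘ-fromℚᵘ (mkℚᵘ (+ b) m)) ⟨
  toℚᵘ (frac a (suc m)) ℚᵘ.+ toℚᵘ (frac b (suc m)) ≃⟨ ℚ.toℚᵘ-homo-+ (frac a (suc m)) (frac b (suc m)) ⟨
  toℚᵘ (frac a (suc m) +ℚ frac b (suc m))       ∎)
  where open ℚᵘ.≤-Reasoning

module _ {A : Set} where

  count-mono : (E D : A → Bool) → (∀ x → E x ≡ true → D x ≡ true)
             → ∀ xs → count E xs ≤ count D xs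
  count-mono E D E⊆D [] = ℕ.≤-refl
  count-mono E D E⊆D (x ∷ xs) with E x in Ex | D x in Dx
  ... | false | false = count-mono E D E⊆D xs
  ... | false | true  = ℕ.m≤n⇒m≤1+n (count-mono E D E⊆D xs)
  ... | true  | true  = s≤s (count-mono E D E⊆D xs)
  ... | true  | false with () ← trans (sym Dx) (E⊆D x Ex)

  count-∨-≤ : (B C : A → Bool) → ∀ xs → count (λ x → B x ∨ C x) xs ≤ count B xs + count C xs
  count-∨-≤ B C [] = ℕ.≤-refl
  count-∨-≤ B C (x ∷ xs) with B x | C x | count-∨-≤ B C xs
  ... | false | false | ih = ih
  ... | false | true  | ih = ℕ.≤-trans (s≤s ih) (ℕ.≤-reflexive (sym (ℕ.+-suc (count B xs) (count C xs))))
  ... | true  | false | ih = s≤s ih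
  ... | true  | true  | ih = s≤s (ℕ.≤-trans ih (ℕ.+-monoʳ-≤ (count B xs) (ℕ.n≤1+n (count C xs))))

Pr-union-bound : ∀ {n} (Y : Complex n) t (E B C : Outcome n → Bool)
               → (∀ ω → E ω ≡ true → B ω ∨ C ω ≡ true)
               → Pr Y t E ≤ℚ Pr Y t B +ℚ Pr Y t C
Pr-union-bound {n} Y t E B C E⊆B∪C = begin
  frac (count E Ω) N                   ≤⟨ frac-mono-≤ N (ℕ.≤-trans (count-mono E B∨C E⊆B∪C Ω) (count-∨-≤ B C Ω)) ⟩
  frac (count B Ω + count C Ω) N       ≡⟨ frac-+ (count B Ω) (count C Ω) N ⟩
  frac (count B Ω) N +ℚ frac (count C Ω) N ∎
  where
  open ℚ.≤-Reasoning
  Ω : List (Outcome n)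
  Ω = outcomes Y t
  N : ℕ
  N = length Ω
  B∨C : Outcome n → Bool
  B∨C ω = B ω ∨ C ω

a∧c⇒[b∧c]∨[a∧¬b] : ∀ a b c → a ∧ c ≡ true → (b ∧ c) ∨ (a ∧ not b) ≡ true
a∧c⇒[b∧c]∨[a∧¬b] true true  true _ = refl
a∧c⇒[b∧c]∨[a∧¬b] true false true _ = refl

Pr-∧-split : ∀ {n} (Y : Complex n) t (A B C : Outcome n → Bool)
           → Pr Y t (λ ω → A ω ∧ C ω) ≤ℚ Pr Y t (λ ω → B ω ∧ C ω) +ℚ Pr Y t (λ ω → A ω ∧ not (B ω))
Pr-∧-split Y t A B C =
  Pr-union-bound Y t _ _ _ (λ ω → a∧c⇒[b∧c]∨[a∧¬b] (A ω) (B ω) (C ω))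

telescope : (a g : ℕ → ℚ) → (∀ k → a (suc k) ≤ℚ a k +ℚ g k)
          → ∀ m → a m ≤ℚ a 0 +ℚ sumℚ (applyUpTo g m)
telescope a g step zero = ℚ.≤-reflexive (sym (ℚ.+-identityʳ (a 0)))
telescope a g step (suc m) = begin
  a (suc m)          ≤⟨ telescope (a ∘ suc) (g ∘ suc) (step ∘ suc) m ⟩
  a 1 +ℚ Σ           ≤⟨ ℚ.+-monoˡ-≤ Σ (step 0) ⟩
  (a 0 +ℚ g 0) +ℚ Σ  ≡⟨ ℚ.+-assoc (a 0) (g 0) Σ ⟩
  a 0 +ℚ (g 0 +ℚ Σ)  ∎
  where
  open ℚ.≤-Reasoning
  Σ : ℚ
  Σ = sumℚ (applyUpTo (g ∘ suc) m)

telescope-from : (a g : ℕ → ℚ) → (∀ k → a (suc k) ≤ℚ a k +ℚ g k)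
               → ∀ b m → a (b + m) ≤ℚ a b +ℚ sumℚ (map g (map (λ l → b + l) (upTo m)))
telescope-from a g step b m =
  subst₂ (λ b′ gs → a (b + m) ≤ℚ a b′ +ℚ sumℚ gs) (ℕ.+-identityʳ b) shifted
    (telescope (a ∘ (λ l → b + l)) (g ∘ (λ l → b + l)) step-from m)
  where
  step-from : ∀ k → a (b + suc k) ≤ℚ a (b + k) +ℚ g (b + k)
  step-from k = subst (λ l → a l ≤ℚ a (b + k) +ℚ g (b + k)) (sym (ℕ.+-suc b k)) (step (b + k))
  shifted : applyUpTo (g ∘ (λ l → b + l)) m ≡ map g (map (λ l → b + l) (upTo m))
  shifted = sym (trans (cong (map g) (List.map-upTo (λ l → b + l) m)) (List.map-applyUpTo (λ l → b + l) g m))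

lemma2p11 : (n d i : ℕ) (X : Complex n) → IsComplex X → IsPure X d → i < d
    → (η : ℚ) → 0ℚ <ℚ η → η <ℚ 1ℚ
    → (W : FaceSet n) → ((σ : _) → W σ ≡ true → (X σ ≡ true) × (∣ σ ∣ ≡ suc i))
    → (j : ℕ) → j ≤ i
    → Pr X (suc d) (λ ω → F X (suc d) η (suc i) W (suc (suc i)) (P (suc d) (suc (suc i)) ω)
                          ∧ not (S X (suc d) η (suc i) W j (P (suc d) j ω)))
      ≤ℚ (Pr X (suc d) (λ ω → F X (suc d) η (suc i) W (suc (suc j)) (P (suc d) (suc (suc j)) ω)
                          ∧ not (S X (suc d) η (suc i) W j (P (suc d) j ω)))
         +ℚ sumℚ (map (λ k → Pr X (suc d) (λ ω → F X (suc d) η (suc i) W (suc k) (P (suc d) (suc k) ω)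
                                                ∧ not (F X (suc d) η (suc i) W k (P (suc d) k ω))))
                      (map (λ l → j + 2 + l) (upTo (i ∸ j)))))
lemma2p11 n d i X _ _ _ η _ _ W _ j j≤i =
  subst₂ (λ top bottom → fullNotFat top
                           ≤ℚ fullNotFat bottom +ℚ sumℚ (map newlyFull (map (λ l → j + 2 + l) (upTo (i ∸ j)))))
    top≡ bottom≡ (telescope-from fullNotFat newlyFull step (j + 2) (i ∸ j))
  where
  full : ℕ → Outcome n → Bool
  full s ω = F X (suc d) η (suc i) W s (P (suc d) s ω)
  notFat : Outcome n → Bool
  notFat ω = not (S X (suc d) η (suc i) W j (P (suc d) j ω))
  fullNotFat newlyFull : ℕ → ℚ
  fullNotFat s = Pr X (suc d) (λ ω → full s ω ∧ notFat ω)
  newlyFull k = Pr X (suc d) (λ ω → full (suc k) ω ∧ not (full k ω))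
  step : ∀ k → fullNotFat (suc k) ≤ℚ fullNotFat k +ℚ newlyFull k
  step k = Pr-∧-split X (suc d) (full (suc k)) (full k) notFat
  top≡ : j + 2 + (i ∸ j) ≡ suc (suc i)
  top≡ = trans (cong (λ x → x + (i ∸ j)) (ℕ.+-comm j 2)) (cong (suc ∘ suc) (ℕ.m+[n∸m]≡n j≤i))
  bottom≡ : j + 2 ≡ suc (suc j)
  bottom≡ = ℕ.+-comm j 2
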